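{- Let $G$ and $H$ be simple graphs with $n_1$ and $n_2$ vertices respectively, let $G\Box H$ be their Cartesian product and $G\times H$ their tensor product, with vertex set $V(G)\times V(H)$ ordered lexicographically (so that adjacency matrices are compatible with Kronecker products, e.g. $A_{G\times H}=A_G\otimes A_H$). Then \[ L^{(2)}_{G\Box H}=L^{(2)}_G\otimes I_{n_2}+I_{n_1}\otimes L^{(2)}_H-\frac{1}{6}L_{G\times H}, \] where $L_{G\times H}$ is the ordinary Laplacian of $G\times H$.
   Context: For a simple graph $G$ with adjacency matrix $A_G$ and degree matrix $D_G$ (diagonal matrix of vertex degrees), let $A'=\frac{1}{12}\left(16A_G-A_G^2+D_G\right)$ and let $D'$ be the diagonal matrix whose $(i,i)$ entry is the sum of the entries of the $i$th row of $A'$. The $2$-Laplacian of $G$ is $L^{(2)}_G=D'-A'$; the ordinary Laplacian is $L_G=D_G-A_G$. The Cartesian product $G\Box H$ has vertex set $V(G)\times V(H)$, with $(v,w)$ adjacent to $(v',w')$ iff either $v=v'$ and $w\sim w'$ in $H$, or $w=w'$ and $v\sim v'$ in $G$. The tensor product $G\times H$ has vertex set $V(G)\times V(H)$, with $(v,w)$ adjacent to $(v',w')$ iff $v\sim v'$ in $G$ and $w\sim w'$ in $H$. $\otimes$ denotes the Kronecker product. -}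

module Defs where

open import Data.Nat using (ℕ; zero; suc; _*_)
open import Data.Fin using (Fin; zero; suc; remQuot; quotient; remainder; _≟_)
open import Data.Bool using (Bool; true; false; _∧_; _∨_; if_then_else_)
open import Data.Integer using (+_)
open import Data.Rational using (ℚ; 0ℚ; 1ℚ) renaming (_+_ to _+ℚ_; _*_ to _*ℚ_; _-_ to _-ℚ_; _/_ to _/ℚ_)
open import Relation.Nullary.Decidable using (⌊_⌋)
open import Relation.Binary.PropositionalEquality using (_≡_)
open import Data.Product using (_×_)

Graph : ℕ → Set
Graph n = Fin n → Fin n → Bool

IsSimple : ∀ {n} → Graph n → Set
IsSimple {n} g = (∀ (i j : Fin n) → g i j ≡ g j i) × (∀ (i : Fin n) → g i i ≡ false)

Mat : ℕ → ℕ → Set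
Mat m n = Fin m → Fin n → ℚ

Σℚ : ∀ n → (Fin n → ℚ) → ℚ
Σℚ zero    f = 0ℚ
Σℚ (suc n) f = f zero +ℚ Σℚ n (λ i → f (suc i))

_⊕_ : ∀ {m n} → Mat m n → Mat m n → Mat m n
(A ⊕ B) i j = A i j +ℚ B i j

_⊖_ : ∀ {m n} → Mat m n → Mat m n → Mat m n
(A ⊖ B) i j = A i j -ℚ B i j

_·_ : ∀ {m n} → ℚ → Mat m n → Mat m n
(c · A) i j = c *ℚ A i j

_⊛_ : ∀ {m n p} → Mat m n → Mat n p → Mat m p
_⊛_ {n = n} A B i k = Σℚ n (λ j → A i j *ℚ B j k)

I : ∀ n → Mat n n
I n i j = if ⌊ i ≟ j ⌋ then 1ℚ else 0ℚ

rowSumDiag : ∀ {n} → Mat n n → Mat n n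
rowSumDiag {n} A i j = if ⌊ i ≟ j ⌋ then Σℚ n (A i) else 0ℚ

-- Kronecker product, indices of Fin (m₁ * m₂) read lexicographically
-- (index combine i j = i * m₂ + j corresponds to pair (i , j)).
_⊗_ : ∀ {m₁ n₁ m₂ n₂} → Mat m₁ n₁ → Mat m₂ n₂ → Mat (m₁ * m₂) (n₁ * n₂)
_⊗_ {m₁} {n₁} {m₂} {n₂} A B p q =
  A (quotient {m₁} m₂ p) (quotient {n₁} n₂ q) *ℚ B (remainder {m₁} m₂ p) (remainder {n₁} n₂ q)

adjMat : ∀ {n} → Graph n → Mat n n
adjMat g i j = if g i j then 1ℚ else 0ℚ

degMat : ∀ {n} → Graph n → Mat n n
degMat g = rowSumDiag (adjMat g)

laplacian : ∀ {n} → Graph n → Mat n n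
laplacian g = degMat g ⊖ adjMat g

A′ : ∀ {n} → Graph n → Mat n n
A′ g = (+ 1 /ℚ 12) · ((((+ 16 /ℚ 1) · adjMat g) ⊖ (adjMat g ⊛ adjMat g)) ⊕ degMat g)

laplacian2 : ∀ {n} → Graph n → Mat n n
laplacian2 g = rowSumDiag (A′ g) ⊖ A′ g

_□_ : ∀ {n₁ n₂} → Graph n₁ → Graph n₂ → Graph (n₁ * n₂)
_□_ {n₁} {n₂} g h p q =
  (⌊ quotient {n₁} n₂ p ≟ quotient {n₁} n₂ q ⌋ ∧ h (remainder {n₁} n₂ p) (remainder {n₁} n₂ q))
  ∨ (⌊ remainder {n₁} n₂ p ≟ remainder {n₁} n₂ q ⌋ ∧ g (quotient {n₁} n₂ p) (quotient {n₁} n₂ q))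

_⨯_ : ∀ {n₁ n₂} → Graph n₁ → Graph n₂ → Graph (n₁ * n₂)
_⨯_ {n₁} {n₂} g h p q =
  g (quotient {n₁} n₂ p) (quotient {n₁} n₂ q) ∧ h (remainder {n₁} n₂ p) (remainder {n₁} n₂ q)

{-# OPTIONS --safe #-}
module Submission where

-- Index V(G) × V(H) lexicographically and write P ⊞ Q = P ⊗ I + I ⊗ Q for the Kronecker sum.
-- Then A_{G□H} = A_G ⊞ A_H and A_{G×H} = A_G ⊗ A_H. The mixed-product rule
-- (X ⊗ Y)(Z ⊗ W) = XZ ⊗ YW gives A_{G□H}² = A_G² ⊞ A_H² + 2 A_G ⊗ A_H, and as row sums of a
-- Kronecker product multiply, D_{G□H} = D_G ⊞ D_H. Substituting into A′ = (16A − A² + D)/12,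
-- A′_{G□H} = A′_G ⊞ A′_H − (1/6) A_G ⊗ A_H, and taking row sums once more,
-- D′_{G□H} = D′_G ⊞ D′_H − (1/6) D_G ⊗ D_H. Subtracting, the correction term is
-- (1/6)(D_G ⊗ D_H − A_G ⊗ A_H) = (1/6) L_{G×H}.

open import Defs
open import Data.Nat using (ℕ; zero; suc) renaming (_+_ to _+ℕ_; _*_ to _*ℕ_)
open import Data.Fin using (Fin; zero; suc; quotient; remainder; combine; _↑ˡ_; _↑ʳ_; _≟_)
open import Data.Fin.Properties using (remQuot-combine; combine-remQuot)
open import Data.Bool using (Bool; true; false; T; if_then_else_; _∧_; _∨_)
open import Data.Integer using (+_)
open import Data.Rational using (ℚ; _/_; 0ℚ; 1ℚ; _+_; _*_; -_; _-_)
import Data.Rational.Properties as ℚ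
open import Data.Rational.Solver using (module +-*-Solver)
open import Data.Product using (_,_; proj₁; proj₂)
open import Data.Empty using (⊥-elim)
open import Relation.Nullary.Decidable using (Dec; ⌊_⌋; yes; no; toWitness)
open import Relation.Binary.PropositionalEquality
open import Relation.Binary.Bundles using (Setoid)
import Relation.Binary.Reasoning.Setoid as SetoidReasoning
open import Algebra.Bundles using (CommutativeRing; CommutativeMonoid)
open import Algebra.Properties.Semiring.Sum (CommutativeRing.semiring ℚ.+-*-commutativeRing)
  using (sum; ∑-distrib-+; *-distribˡ-sum; *-distribʳ-sum; sum-cong-≗; sum-replicate-zero)
open import Algebra.Properties.CommutativeSemigroup
  (CommutativeMonoid.commutativeSemigroup ℚ.*-1-commutativeMonoid) using (interchange)

open +-*-Solver using (solve; _:=_; _:+_; _:*_; _:-_)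

Σℚ≡sum : ∀ n (f : Fin n → ℚ) → Σℚ n f ≡ sum f
Σℚ≡sum zero    f = refl
Σℚ≡sum (suc n) f = cong (_+_ (f zero)) (Σℚ≡sum n (λ i → f (suc i)))

Σ-cong : ∀ n {f g : Fin n → ℚ} → (∀ i → f i ≡ g i) → Σℚ n f ≡ Σℚ n g
Σ-cong n {f} {g} f≗g =
  trans (Σℚ≡sum n f) (trans (sum-cong-≗ f≗g) (sym (Σℚ≡sum n g)))

Σ-zero : ∀ n → Σℚ n (λ _ → 0ℚ) ≡ 0ℚ
Σ-zero n = trans (Σℚ≡sum n _) (sum-replicate-zero n)

Σ-distrib-+ : ∀ n (f g : Fin n → ℚ) → Σℚ n (λ i → f i + g i) ≡ Σℚ n f + Σℚ n g
Σ-distrib-+ n f g = trans (Σℚ≡sum n _)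
  (trans (∑-distrib-+ f g) (sym (cong₂ _+_ (Σℚ≡sum n f) (Σℚ≡sum n g))))

Σ-neg : ∀ n (f : Fin n → ℚ) → Σℚ n (λ i → - f i) ≡ - Σℚ n f
Σ-neg zero    f = refl
Σ-neg (suc n) f =
  trans (cong (_+_ (- f zero)) (Σ-neg n (λ i → f (suc i))))
        (sym (ℚ.neg-distrib-+ (f zero) (Σℚ n (λ i → f (suc i)))))

Σ-distrib-- : ∀ n (f g : Fin n → ℚ) → Σℚ n (λ i → f i - g i) ≡ Σℚ n f - Σℚ n g
Σ-distrib-- n f g = trans (Σ-distrib-+ n f (λ i → - g i)) (cong (_+_ (Σℚ n f)) (Σ-neg n g))

Σ-*ˡ : ∀ n c (f : Fin n → ℚ) → Σℚ n (λ i → c * f i) ≡ c * Σℚ n f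
Σ-*ˡ n c f = trans (Σℚ≡sum n _)
  (trans (sym (*-distribˡ-sum c f)) (cong (c *_) (sym (Σℚ≡sum n f))))

Σ-*ʳ : ∀ n c (f : Fin n → ℚ) → Σℚ n (λ i → f i * c) ≡ Σℚ n f * c
Σ-*ʳ n c f = trans (Σℚ≡sum n _)
  (trans (sym (*-distribʳ-sum c f)) (cong (_* c) (sym (Σℚ≡sum n f))))

Σ-++ : ∀ m n (f : Fin (m +ℕ n) → ℚ) →
       Σℚ (m +ℕ n) f ≡ Σℚ m (λ i → f (i ↑ˡ n)) + Σℚ n (λ j → f (m ↑ʳ j))
Σ-++ zero    n f = sym (ℚ.+-identityˡ _)
Σ-++ (suc m) n f =
  trans (cong (_+_ (f zero)) (Σ-++ m n (λ i → f (suc i)))) (sym (ℚ.+-assoc (f zero) _ _))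

Σ-combine : ∀ m n (f : Fin (m *ℕ n) → ℚ) →
            Σℚ (m *ℕ n) f ≡ Σℚ m (λ i → Σℚ n (λ j → f (combine i j)))
Σ-combine zero    n f = refl
Σ-combine (suc m) n f =
  trans (Σ-++ n (m *ℕ n) f)
        (cong (_+_ (Σℚ n (λ j → f (j ↑ˡ (m *ℕ n))))) (Σ-combine m n (λ r → f (n ↑ʳ r))))

Σ-remQuot : ∀ m n (F : Fin m → Fin n → ℚ) →
            Σℚ (m *ℕ n) (λ r → F (quotient n r) (remainder {m} n r)) ≡ Σℚ m (λ i → Σℚ n (F i))
Σ-remQuot m n F = trans (Σ-combine m n _) (Σ-cong m λ i → Σ-cong n λ j →
  cong₂ F (cong proj₁ (remQuot-combine i j)) (cong proj₂ (remQuot-combine i j)))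

Σ-kron : ∀ m n (f : Fin m → ℚ) (g : Fin n → ℚ) →
         Σℚ (m *ℕ n) (λ r → f (quotient n r) * g (remainder {m} n r)) ≡ Σℚ m f * Σℚ n g
Σ-kron m n f g = begin
  Σℚ (m *ℕ n) (λ r → f (quotient n r) * g (remainder {m} n r))
    ≡⟨ Σ-remQuot m n (λ i j → f i * g j) ⟩
  Σℚ m (λ i → Σℚ n (λ j → f i * g j))
    ≡⟨ Σ-cong m (λ i → Σ-*ˡ n (f i) g) ⟩
  Σℚ m (λ i → f i * Σℚ n g)
    ≡⟨ Σ-*ʳ m (Σℚ n g) f ⟩
  Σℚ m f * Σℚ n g ∎
  where open ≡-Reasoning

-- Both adjMat g i j and I n i j unfold to indicators: 𝟙 (g i j) and 𝟙 ⌊ i ≟ j ⌋.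
𝟙 : Bool → ℚ
𝟙 b = if b then 1ℚ else 0ℚ

𝟙-∧ : ∀ x y → 𝟙 (x ∧ y) ≡ 𝟙 x * 𝟙 y
𝟙-∧ true  y = sym (ℚ.*-identityˡ (𝟙 y))
𝟙-∧ false y = sym (ℚ.*-zeroˡ (𝟙 y))

I-suc : ∀ n (i j : Fin n) → I (suc n) (suc i) (suc j) ≡ I n i j
I-suc n i j with i ≟ j
... | yes _ = refl
... | no  _ = refl

Σ-I* : ∀ n i (g : Fin n → ℚ) → Σℚ n (λ j → I n i j * g j) ≡ g i
Σ-I* (suc n) zero g = begin
  1ℚ * g zero + Σℚ n (λ j → 0ℚ * g (suc j))
    ≡⟨ cong₂ _+_ (ℚ.*-identityˡ (g zero)) (Σ-cong n (λ j → ℚ.*-zeroˡ (g (suc j)))) ⟩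
  g zero + Σℚ n (λ _ → 0ℚ)
    ≡⟨ trans (cong (_+_ (g zero)) (Σ-zero n)) (ℚ.+-identityʳ (g zero)) ⟩
  g zero ∎
  where open ≡-Reasoning
Σ-I* (suc n) (suc i) g = begin
  0ℚ * g zero + Σℚ n (λ j → I (suc n) (suc i) (suc j) * g (suc j))
    ≡⟨ cong₂ _+_ (ℚ.*-zeroˡ (g zero)) (Σ-cong n (λ j → cong (_* g (suc j)) (I-suc n i j))) ⟩
  0ℚ + Σℚ n (λ j → I n i j * g (suc j))
    ≡⟨ trans (ℚ.+-identityˡ _) (Σ-I* n i (λ j → g (suc j))) ⟩
  g (suc i) ∎
  where open ≡-Reasoning

I-sym : ∀ n (i j : Fin n) → I n i j ≡ I n j i
I-sym n i j with i ≟ j | j ≟ i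
... | yes _   | yes _   = refl
... | no  _   | no  _   = refl
... | yes i≡j | no  j≢i = ⊥-elim (j≢i (sym i≡j))
... | no  i≢j | yes j≡i = ⊥-elim (i≢j (sym j≡i))

Σ-*I : ∀ n i (g : Fin n → ℚ) → Σℚ n (λ j → g j * I n j i) ≡ g i
Σ-*I n i g =
  trans (Σ-cong n (λ j → trans (ℚ.*-comm (g j) _) (cong (_* g j) (I-sym n j i)))) (Σ-I* n i g)

Σ-I : ∀ n i → Σℚ n (I n i) ≡ 1ℚ
Σ-I n i = trans (Σ-cong n (λ j → sym (ℚ.*-identityʳ (I n i j)))) (Σ-I* n i (λ _ → 1ℚ))

infix 4 _≋_
_≋_ : ∀ {m n} → Mat m n → Mat m n → Set
X ≋ Y = ∀ i j → X i j ≡ Y i j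

≋-refl : ∀ {m n} {X : Mat m n} → X ≋ X
≋-refl _ _ = refl

≋-sym : ∀ {m n} {X Y : Mat m n} → X ≋ Y → Y ≋ X
≋-sym X≋Y i j = sym (X≋Y i j)

≋-trans : ∀ {m n} {X Y Z : Mat m n} → X ≋ Y → Y ≋ Z → X ≋ Z
≋-trans X≋Y Y≋Z i j = trans (X≋Y i j) (Y≋Z i j)

≋-setoid : ℕ → ℕ → Setoid _ _
≋-setoid m n = record
  { Carrier       = Mat m n
  ; _≈_           = _≋_
  ; isEquivalence = record { refl = ≋-refl ; sym = ≋-sym ; trans = ≋-trans }
  }

module ≋-Reasoning {m n : ℕ} = SetoidReasoning (≋-setoid m n)

⊕-cong : ∀ {m n} {X X′ Y Y′ : Mat m n} → X ≋ X′ → Y ≋ Y′ → X ⊕ Y ≋ X′ ⊕ Y′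
⊕-cong X≋X′ Y≋Y′ i j = cong₂ _+_ (X≋X′ i j) (Y≋Y′ i j)

⊖-cong : ∀ {m n} {X X′ Y Y′ : Mat m n} → X ≋ X′ → Y ≋ Y′ → X ⊖ Y ≋ X′ ⊖ Y′
⊖-cong X≋X′ Y≋Y′ i j = cong₂ _-_ (X≋X′ i j) (Y≋Y′ i j)

·-cong : ∀ {m n} c {X Y : Mat m n} → X ≋ Y → c · X ≋ c · Y
·-cong c X≋Y i j = cong (c *_) (X≋Y i j)

⊛-cong : ∀ {m n p} {X X′ : Mat m n} {Y Y′ : Mat n p} → X ≋ X′ → Y ≋ Y′ → X ⊛ Y ≋ X′ ⊛ Y′
⊛-cong {n = n} X≋X′ Y≋Y′ i k = Σ-cong n (λ j → cong₂ _*_ (X≋X′ i j) (Y≋Y′ j k))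

⊗-cong : ∀ {m₁ n₁ m₂ n₂} {X X′ : Mat m₁ n₁} {Y Y′ : Mat m₂ n₂} →
         X ≋ X′ → Y ≋ Y′ → X ⊗ Y ≋ X′ ⊗ Y′
⊗-cong {m₁} {n₁} {m₂} {n₂} X≋X′ Y≋Y′ p q =
  cong₂ _*_ (X≋X′ (quotient m₂ p) (quotient n₂ q))
            (Y≋Y′ (remainder {m₁} m₂ p) (remainder {n₁} n₂ q))

rowSumDiag-cong : ∀ {n} {X Y : Mat n n} → X ≋ Y → rowSumDiag X ≋ rowSumDiag Y
rowSumDiag-cong {n} X≋Y i j = cong (λ s → if ⌊ i ≟ j ⌋ then s else 0ℚ) (Σ-cong n (X≋Y i))

⊛-identityˡ : ∀ {n p} (X : Mat n p) → I n ⊛ X ≋ X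
⊛-identityˡ {n} X i k = Σ-I* n i (λ j → X j k)

⊛-identityʳ : ∀ {m n} (X : Mat m n) → X ⊛ I n ≋ X
⊛-identityʳ {n = n} X i k = Σ-*I n k (X i)

⊛-distribˡ-⊕ : ∀ {m n p} (X : Mat m n) (Y Z : Mat n p) → X ⊛ (Y ⊕ Z) ≋ (X ⊛ Y) ⊕ (X ⊛ Z)
⊛-distribˡ-⊕ {n = n} X Y Z i k =
  trans (Σ-cong n (λ j → ℚ.*-distribˡ-+ (X i j) (Y j k) (Z j k))) (Σ-distrib-+ n _ _)

⊛-distribʳ-⊕ : ∀ {m n p} (X : Mat n p) (Y Z : Mat m n) → (Y ⊕ Z) ⊛ X ≋ (Y ⊛ X) ⊕ (Z ⊛ X)
⊛-distribʳ-⊕ {n = n} X Y Z i k =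
  trans (Σ-cong n (λ j → ℚ.*-distribʳ-+ (X j k) (Y i j) (Z i j))) (Σ-distrib-+ n _ _)

rowSumDiag-entry : ∀ {n} (X : Mat n n) i j → rowSumDiag X i j ≡ I n i j * Σℚ n (X i)
rowSumDiag-entry {n} X i j with i ≟ j
... | yes _ = sym (ℚ.*-identityˡ (Σℚ n (X i)))
... | no  _ = sym (ℚ.*-zeroˡ (Σℚ n (X i)))

rowSumDiag-⊕ : ∀ {n} (X Y : Mat n n) → rowSumDiag (X ⊕ Y) ≋ rowSumDiag X ⊕ rowSumDiag Y
rowSumDiag-⊕ {n} X Y i j with i ≟ j
... | yes _ = Σ-distrib-+ n (X i) (Y i)
... | no  _ = refl

rowSumDiag-⊖ : ∀ {n} (X Y : Mat n n) → rowSumDiag (X ⊖ Y) ≋ rowSumDiag X ⊖ rowSumDiag Y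
rowSumDiag-⊖ {n} X Y i j with i ≟ j
... | yes _ = Σ-distrib-- n (X i) (Y i)
... | no  _ = refl

rowSumDiag-· : ∀ {n} c (X : Mat n n) → rowSumDiag (c · X) ≋ c · rowSumDiag X
rowSumDiag-· {n} c X i j with i ≟ j
... | yes _ = Σ-*ˡ n c (X i)
... | no  _ = sym (ℚ.*-zeroʳ c)

rowSumDiag-I : ∀ n → rowSumDiag (I n) ≋ I n
rowSumDiag-I n i j with i ≟ j
... | yes _ = Σ-I n i
... | no  _ = refl

⊖-·-interchange : ∀ {m n} k (X X′ Y Y′ : Mat m n) →
                  (X ⊖ (k · Y)) ⊖ (X′ ⊖ (k · Y′)) ≋ (X ⊖ X′) ⊖ (k · (Y ⊖ Y′))
⊖-·-interchange k X X′ Y Y′ i j =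
  solve 5 (λ k x x′ y y′ → (x :- k :* y) :- (x′ :- k :* y′) := (x :- x′) :- k :* (y :- y′))
    refl k (X i j) (X′ i j) (Y i j) (Y′ i j)

module _ {m n : ℕ} where

  remQuot-injective : ∀ {p q : Fin (m *ℕ n)} → quotient {m} n p ≡ quotient {m} n q →
                      remainder {m} n p ≡ remainder {m} n q → p ≡ q
  remQuot-injective {p} {q} a≡c b≡d =
    trans (sym (combine-remQuot {m} n p)) (trans (cong₂ combine a≡c b≡d) (combine-remQuot {m} n q))

  I-⊗ : I (m *ℕ n) ≋ I m ⊗ I n
  I-⊗ p q =
    cases (p ≟ q) (quotient {m} n p ≟ quotient {m} n q) (remainder {m} n p ≟ remainder {m} n q)
    where
    cases : (p? : Dec (p ≡ q)) (a? : Dec (quotient {m} n p ≡ quotient {m} n q))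
            (b? : Dec (remainder {m} n p ≡ remainder {m} n q)) → 𝟙 ⌊ p? ⌋ ≡ 𝟙 ⌊ a? ⌋ * 𝟙 ⌊ b? ⌋
    cases (yes _)   (yes _)   (yes _)   = refl
    cases (yes p≡q) (no a≢c)  _         = ⊥-elim (a≢c (cong (quotient {m} n) p≡q))
    cases (yes p≡q) (yes _)   (no b≢d)  = ⊥-elim (b≢d (cong (remainder {m} n) p≡q))
    cases (no p≢q)  (yes a≡c) (yes b≡d) = ⊥-elim (p≢q (remQuot-injective a≡c b≡d))
    cases (no _)    (yes _)   (no _)    = refl
    cases (no _)    (no _)    b?        = sym (ℚ.*-zeroˡ (𝟙 ⌊ b? ⌋))

⊗-⊛ : ∀ {m₁ n₁ p₁ m₂ n₂ p₂} (X : Mat m₁ n₁) (Y : Mat m₂ n₂) (Z : Mat n₁ p₁) (W : Mat n₂ p₂) →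
      (X ⊗ Y) ⊛ (Z ⊗ W) ≋ (X ⊛ Z) ⊗ (Y ⊛ W)
⊗-⊛ {m₁} {n₁} {p₁} {m₂} {n₂} {p₂} X Y Z W p q =
  trans (Σ-cong (n₁ *ℕ n₂) (λ r →
           interchange (X a (quotient n₂ r)) (Y b (remainder {n₁} n₂ r)) _ _))
        (Σ-kron n₁ n₂ (λ i → X a i * Z i c) (λ j → Y b j * W j d))
  where
  a = quotient {m₁} m₂ p
  b = remainder {m₁} m₂ p
  c = quotient {p₁} p₂ q
  d = remainder {p₁} p₂ q

rowSumDiag-⊗ : ∀ {m n} (X : Mat m m) (Y : Mat n n) →
               rowSumDiag (X ⊗ Y) ≋ rowSumDiag X ⊗ rowSumDiag Y
rowSumDiag-⊗ {m} {n} X Y p q = begin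
  rowSumDiag (X ⊗ Y) p q
    ≡⟨ rowSumDiag-entry (X ⊗ Y) p q ⟩
  I (m *ℕ n) p q * Σℚ (m *ℕ n) ((X ⊗ Y) p)
    ≡⟨ cong₂ _*_ (I-⊗ {m} {n} p q) (Σ-kron m n (X a) (Y b)) ⟩
  (I m a c * I n b d) * (Σℚ m (X a) * Σℚ n (Y b))
    ≡⟨ interchange (I m a c) _ _ _ ⟩
  (I m a c * Σℚ m (X a)) * (I n b d * Σℚ n (Y b))
    ≡˘⟨ cong₂ _*_ (rowSumDiag-entry X a c) (rowSumDiag-entry Y b d) ⟩
  rowSumDiag X a c * rowSumDiag Y b d ∎
  where
  open ≡-Reasoning
  a = quotient {m} n p
  b = remainder {m} n p
  c = quotient {m} n q
  d = remainder {m} n q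

_⊞_ : ∀ {m n} → Mat m m → Mat n n → Mat (m *ℕ n) (m *ℕ n)
_⊞_ {m} {n} P Q = (P ⊗ I n) ⊕ (I m ⊗ Q)

module _ {m n : ℕ} where
  open ≋-Reasoning

  rowSumDiag-⊞ : (P : Mat m m) (Q : Mat n n) → rowSumDiag (P ⊞ Q) ≋ rowSumDiag P ⊞ rowSumDiag Q
  rowSumDiag-⊞ P Q = begin
    rowSumDiag ((P ⊗ I n) ⊕ (I m ⊗ Q))
      ≈⟨ rowSumDiag-⊕ (P ⊗ I n) (I m ⊗ Q) ⟩
    rowSumDiag (P ⊗ I n) ⊕ rowSumDiag (I m ⊗ Q)
      ≈⟨ ⊕-cong (rowSumDiag-⊗ P (I n)) (rowSumDiag-⊗ (I m) Q) ⟩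
    (rowSumDiag P ⊗ rowSumDiag (I n)) ⊕ (rowSumDiag (I m) ⊗ rowSumDiag Q)
      ≈⟨ ⊕-cong (⊗-cong {X = rowSumDiag P} ≋-refl (rowSumDiag-I n))
                (⊗-cong {Y = rowSumDiag Q} (rowSumDiag-I m) ≋-refl) ⟩
    rowSumDiag P ⊞ rowSumDiag Q ∎

  ⊞-square : (P : Mat m m) (Q : Mat n n) →
             (P ⊞ Q) ⊛ (P ⊞ Q) ≋ (((P ⊛ P) ⊗ I n) ⊕ (P ⊗ Q)) ⊕ ((P ⊗ Q) ⊕ (I m ⊗ (Q ⊛ Q)))
  ⊞-square P Q = begin
    (P ⊞ Q) ⊛ ((P ⊗ I n) ⊕ (I m ⊗ Q))
      ≈⟨ ⊛-distribˡ-⊕ (P ⊞ Q) (P ⊗ I n) (I m ⊗ Q) ⟩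
    ((P ⊞ Q) ⊛ (P ⊗ I n)) ⊕ ((P ⊞ Q) ⊛ (I m ⊗ Q))
      ≈⟨ ⊕-cong (⊛-distribʳ-⊕ (P ⊗ I n) (P ⊗ I n) (I m ⊗ Q))
                (⊛-distribʳ-⊕ (I m ⊗ Q) (P ⊗ I n) (I m ⊗ Q)) ⟩
    (((P ⊗ I n) ⊛ (P ⊗ I n)) ⊕ ((I m ⊗ Q) ⊛ (P ⊗ I n)))
      ⊕ (((P ⊗ I n) ⊛ (I m ⊗ Q)) ⊕ ((I m ⊗ Q) ⊛ (I m ⊗ Q)))
      ≈⟨ ⊕-cong (⊕-cong (⊗-⊛ P (I n) P (I n)) (⊗-⊛ (I m) Q P (I n)))
                (⊕-cong (⊗-⊛ P (I n) (I m) Q) (⊗-⊛ (I m) Q (I m) Q)) ⟩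
    (((P ⊛ P) ⊗ (I n ⊛ I n)) ⊕ ((I m ⊛ P) ⊗ (Q ⊛ I n)))
      ⊕ (((P ⊛ I m) ⊗ (I n ⊛ Q)) ⊕ ((I m ⊛ I m) ⊗ (Q ⊛ Q)))
      ≈⟨ ⊕-cong (⊕-cong (⊗-cong {X = P ⊛ P} ≋-refl (⊛-identityˡ (I n)))
                        (⊗-cong (⊛-identityˡ P) (⊛-identityʳ Q)))
                (⊕-cong (⊗-cong (⊛-identityʳ P) (⊛-identityˡ Q))
                        (⊗-cong {Y = Q ⊛ Q} (⊛-identityˡ (I m)) ≋-refl)) ⟩
    (((P ⊛ P) ⊗ I n) ⊕ (P ⊗ Q)) ⊕ ((P ⊗ Q) ⊕ (I m ⊗ (Q ⊛ Q))) ∎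

  ⊞-⊖-interchange : (P P′ : Mat m m) (Q Q′ : Mat n n) →
                    (P ⊞ Q) ⊖ (P′ ⊞ Q′) ≋ (P ⊖ P′) ⊞ (Q ⊖ Q′)
  ⊞-⊖-interchange P P′ Q Q′ p q =
    solve 6 (λ x x′ y y′ e f →
        (x :* f :+ e :* y) :- (x′ :* f :+ e :* y′) := (x :- x′) :* f :+ e :* (y :- y′))
      refl (P a c) (P′ a c) (Q b d) (Q′ b d) (I m a c) (I n b d)
    where
    a = quotient {m} n p
    b = remainder {m} n p
    c = quotient {m} n q
    d = remainder {m} n q


Loopless : ∀ {n} → Graph n → Set
Loopless g = ∀ i → g i i ≡ false

𝟙-cartesian : ∀ e u g h → (T e → g ≡ false) → 𝟙 ((e ∧ h) ∨ (u ∧ g)) ≡ 𝟙 g * 𝟙 u + 𝟙 e * 𝟙 h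
𝟙-cartesian true  u     true  h     no-loop with () ← no-loop _
𝟙-cartesian true  true  false true  _ = refl
𝟙-cartesian true  true  false false _ = refl
𝟙-cartesian true  false false true  _ = refl
𝟙-cartesian true  false false false _ = refl
𝟙-cartesian false true  true  true  _ = refl
𝟙-cartesian false true  true  false _ = refl
𝟙-cartesian false true  false true  _ = refl
𝟙-cartesian false true  false false _ = refl
𝟙-cartesian false false true  true  _ = refl
𝟙-cartesian false false true  false _ = refl
𝟙-cartesian false false false true  _ = refl
𝟙-cartesian false false false false _ = refl

module _ {n₁ n₂ : ℕ} (G : Graph n₁) (H : Graph n₂) where

  adjMat-⨯ : adjMat (G ⨯ H) ≋ adjMat G ⊗ adjMat H
  adjMat-⨯ p q =
    𝟙-∧ (G (quotient n₂ p) (quotient n₂ q)) (H (remainder {n₁} n₂ p) (remainder {n₁} n₂ q))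

  degMat-⨯ : degMat (G ⨯ H) ≋ degMat G ⊗ degMat H
  degMat-⨯ = ≋-trans (rowSumDiag-cong adjMat-⨯) (rowSumDiag-⊗ (adjMat G) (adjMat H))

  laplacian-⨯ : laplacian (G ⨯ H) ≋ (degMat G ⊗ degMat H) ⊖ (adjMat G ⊗ adjMat H)
  laplacian-⨯ = ⊖-cong degMat-⨯ adjMat-⨯

  module _ (G-loopless : Loopless G) where

    adjMat-□ : adjMat (G □ H) ≋ adjMat G ⊞ adjMat H
    adjMat-□ p q = 𝟙-cartesian ⌊ a ≟ c ⌋ ⌊ b ≟ d ⌋ (G a c) (H b d)
      (λ a≟c → subst (λ x → G a x ≡ false) (toWitness a≟c) (G-loopless a))
      where
      a = quotient {n₁} n₂ p
      b = remainder {n₁} n₂ p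
      c = quotient {n₁} n₂ q
      d = remainder {n₁} n₂ q

    adjMat²-□ : adjMat (G □ H) ⊛ adjMat (G □ H) ≋
                (((adjMat G ⊛ adjMat G) ⊗ I n₂) ⊕ (adjMat G ⊗ adjMat H))
                ⊕ ((adjMat G ⊗ adjMat H) ⊕ (I n₁ ⊗ (adjMat H ⊛ adjMat H)))
    adjMat²-□ = ≋-trans (⊛-cong adjMat-□ adjMat-□) (⊞-square (adjMat G) (adjMat H))

    degMat-□ : degMat (G □ H) ≋ degMat G ⊞ degMat H
    degMat-□ = ≋-trans (rowSumDiag-cong adjMat-□) (rowSumDiag-⊞ (adjMat G) (adjMat H))

    A′-□ : A′ (G □ H) ≋ (A′ G ⊞ A′ H) ⊖ ((+ 1 / 6) · (adjMat G ⊗ adjMat H))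
    -- The solver's t + t with t = 1/12 evaluates to the 1/6 of the statement.
    A′-□ p q = trans
      (·-cong (+ 1 / 12) (⊕-cong (⊖-cong (·-cong (+ 16 / 1) adjMat-□) adjMat²-□) degMat-□) p q)
      (solve 10 (λ t s x y x² y² dx dy e f →
          t :* ((s :* (x :* f :+ e :* y) :- ((x² :* f :+ x :* y) :+ (x :* y :+ e :* y²)))
                :+ (dx :* f :+ e :* dy))
        := (t :* ((s :* x :- x²) :+ dx) :* f :+ e :* (t :* ((s :* y :- y²) :+ dy)))
           :- (t :+ t) :* (x :* y))
        refl (+ 1 / 12) (+ 16 / 1) (adjMat G a c) (adjMat H b d) ((adjMat G ⊛ adjMat G) a c)
             ((adjMat H ⊛ adjMat H) b d) (degMat G a c) (degMat H b d) (I n₁ a c) (I n₂ b d))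
      where
      a = quotient {n₁} n₂ p
      b = remainder {n₁} n₂ p
      c = quotient {n₁} n₂ q
      d = remainder {n₁} n₂ q

    rowSumDiag-A′-□ : rowSumDiag (A′ (G □ H)) ≋
                      (rowSumDiag (A′ G) ⊞ rowSumDiag (A′ H)) ⊖ ((+ 1 / 6) · (degMat G ⊗ degMat H))
    rowSumDiag-A′-□ = begin
      rowSumDiag (A′ (G □ H))
        ≈⟨ rowSumDiag-cong A′-□ ⟩
      rowSumDiag ((A′ G ⊞ A′ H) ⊖ ((+ 1 / 6) · (adjMat G ⊗ adjMat H)))
        ≈⟨ rowSumDiag-⊖ (A′ G ⊞ A′ H) ((+ 1 / 6) · (adjMat G ⊗ adjMat H)) ⟩
      rowSumDiag (A′ G ⊞ A′ H) ⊖ rowSumDiag ((+ 1 / 6) · (adjMat G ⊗ adjMat H))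
        ≈⟨ ⊖-cong (rowSumDiag-⊞ (A′ G) (A′ H)) (rowSumDiag-· (+ 1 / 6) (adjMat G ⊗ adjMat H)) ⟩
      (rowSumDiag (A′ G) ⊞ rowSumDiag (A′ H)) ⊖ ((+ 1 / 6) · rowSumDiag (adjMat G ⊗ adjMat H))
        ≈⟨ ⊖-cong {X = rowSumDiag (A′ G) ⊞ rowSumDiag (A′ H)} ≋-refl
                  (·-cong (+ 1 / 6) (rowSumDiag-⊗ (adjMat G) (adjMat H))) ⟩
      (rowSumDiag (A′ G) ⊞ rowSumDiag (A′ H)) ⊖ ((+ 1 / 6) · (degMat G ⊗ degMat H)) ∎
      where open ≋-Reasoning

proposition6p4 : (n₁ n₂ : ℕ) (G : Graph n₁) (H : Graph n₂) →
    IsSimple G → IsSimple H →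
    ∀ p q →
      laplacian2 (G □ H) p q ≡
        (((laplacian2 G ⊗ I n₂) ⊕ (I n₁ ⊗ laplacian2 H))
          ⊖ ((+ 1 / 6) · laplacian (G ⨯ H))) p q
proposition6p4 n₁ n₂ G H (_ , G-loopless) _ = begin
  rowSumDiag (A′ (G □ H)) ⊖ A′ (G □ H)
    ≈⟨ ⊖-cong (rowSumDiag-A′-□ G H G-loopless) (A′-□ G H G-loopless) ⟩
  ((rowSumDiag (A′ G) ⊞ rowSumDiag (A′ H)) ⊖ ((+ 1 / 6) · (degMat G ⊗ degMat H)))
    ⊖ ((A′ G ⊞ A′ H) ⊖ ((+ 1 / 6) · (adjMat G ⊗ adjMat H)))
    ≈⟨ ⊖-·-interchange (+ 1 / 6) (rowSumDiag (A′ G) ⊞ rowSumDiag (A′ H)) (A′ G ⊞ A′ H)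
                         (degMat G ⊗ degMat H) (adjMat G ⊗ adjMat H) ⟩
  ((rowSumDiag (A′ G) ⊞ rowSumDiag (A′ H)) ⊖ (A′ G ⊞ A′ H))
    ⊖ ((+ 1 / 6) · ((degMat G ⊗ degMat H) ⊖ (adjMat G ⊗ adjMat H)))
    ≈⟨ ⊖-cong (⊞-⊖-interchange (rowSumDiag (A′ G)) (A′ G) (rowSumDiag (A′ H)) (A′ H))
              (·-cong (+ 1 / 6) (≋-sym (laplacian-⨯ G H))) ⟩
  (laplacian2 G ⊞ laplacian2 H) ⊖ ((+ 1 / 6) · laplacian (G ⨯ H)) ∎
  where open ≋-Reasoning
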